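{- Let $\pi=\sigma_1^{[z_1]}\cdots\sigma_n^{[z_n]}\in\mathsf{G}_{r,n}$ and let $\mathbf f=f(\pi)$ be its minimum sequence. Then $\phi(\pi)\in\mathsf{G}_{r,n,\mathbf f}$.
   Context: $\Sigma=\{i^{[c]}:1\le i\le n,\ c\in\mathbb{Z}/r\mathbb{Z}\}$ (base value $i$, color $c$). $\mathsf{G}_{r,n}$: group under composition of bijections $\pi$ of $\Sigma$ with $\pi(i^{[c]})=\sigma_i^{[z_i+c]}$, $\sigma\in\mathfrak S_n$; window $\pi=\sigma_1^{[z_1]}\cdots\sigma_n^{[z_n]}$. For integers $1\le f_1\le\cdots\le f_n\le n$, $\mathsf{G}_{r,n,\mathbf f}=\{\pi:\sigma_i\le f_i\ \forall i\}$. The minimum sequence $f(\pi)$ is the nondecreasing $\mathbf f$ with $\pi\in\mathsf{G}_{r,n,\mathbf f}$ such that $f_i\le f'_i$ for all $i$ whenever $\pi\in\mathsf{G}_{r,n,\mathbf f'}$; explicitly $f_i=\max\{\sigma_1,\dots,\sigma_i\}$. $\mathsf{CS}_{r,n}=\{(c_1^{[e_1]},\dots,c_n^{[e_n]}):1\le c_i\le i,\ e_i\in\mathbb{Z}/r\mathbb{Z}\}$. A-code$(\pi)=(c_1^{[e_1]},\dots,c_n^{[e_n]})$ with $c_i=|\{j\le i:\sigma^{ -1}(j)\le\sigma^{ -1}(i)\}|$, $e_i=z_{\sigma^{ -1}(i)}$. B-code$(\pi)=(b_1,\dots,b_n)$ with $b_i=\pi^{ -k_i}(i)$, $k_i\ge1$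 least such that the base value of $\pi^{ -k_i}(i)$ is at most $i$. Both are bijections $\mathsf{G}_{r,n}\to\mathsf{CS}_{r,n}$, and $\phi=(\text{B-code})^{ -1}\circ(\text{A-code})$. -}

module Defs where

open import Data.Nat using (ℕ; zero; suc; _+_; _∸_; _≤_; _⊔_; NonZero)
open import Data.Nat.DivMod using (_mod_)
open import Data.Fin using (Fin; toℕ)
open import Data.Fin.Properties using (_≤?_)
open import Data.Fin.Permutation using (Permutation′; _⟨$⟩ʳ_; _⟨$⟩ˡ_)
open import Data.List using (List; length; filter; map; foldr; allFin)
open import Data.Product using (_×_; _,_; proj₁; proj₂)
open import Relation.Nullary.Decidable using (_×-dec_; yes; no)

module _ (r : ℕ) .{{_ : NonZero r}} where

  _+c_ : Fin r → Fin r → Fin r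
  a +c b = (toℕ a + toℕ b) mod r

  _-c_ : Fin r → Fin r → Fin r
  a -c b = (toℕ a + (r ∸ toℕ b)) mod r

-- A colored permutation π = σ₁^[z₁] ⋯ σₙ^[zₙ] ∈ G_{r,n}.
-- Base values are 0-based (Fin n): base value i+1 in the paper is i here.
record CPerm (r n : ℕ) : Set where
  constructor cperm
  field
    σ : Permutation′ n
    z : Fin n → Fin r
open CPerm public

Letter : ℕ → ℕ → Set
Letter r n = Fin n × Fin r

module _ {r n : ℕ} .{{_ : NonZero r}} (π : CPerm r n) where

  σval : Fin n → ℕ
  σval i = suc (toℕ (σ π ⟨$⟩ʳ i))

  apply : Letter r n → Letter r n
  apply (i , c) = (σ π ⟨$⟩ʳ i , _+c_ r (z π i) c)

  applyInv : Letter r n → Letter r n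
  applyInv (j , c) = (σ π ⟨$⟩ˡ j , _-c_ r c (z π (σ π ⟨$⟩ˡ j)))

  minSeq : Fin n → ℕ
  minSeq i = foldr _⊔_ 0 (map σval (filter (λ j → j ≤? i) (allFin n)))

  Acode : Fin n → ℕ × Fin r
  Acode i = ( length (filter (λ j → (j ≤? i) ×-dec ((σ π ⟨$⟩ˡ j) ≤? (σ π ⟨$⟩ˡ i))) (allFin n))
            , z π (σ π ⟨$⟩ˡ i))

  -- Search for π^{-k}(i), k ≥ 1 least with base value ≤ i.
  -- 'fuel' bounds the number of further steps; k ≤ n always holds since the
  -- cycle of i has length ≤ n, so fuel n suffices.
  bsearch : ℕ → Fin n → Letter r n → Letter r n
  bsearch zero    i x = x
  bsearch (suc k) i x with proj₁ (applyInv x) ≤? i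
  ... | yes _ = applyInv x
  ... | no  _ = bsearch k i (applyInv x)

  Bcode : Fin n → ℕ × Fin r
  Bcode i with bsearch n i (i , (0 mod r))
  ... | (b , e) = (suc (toℕ b) , e)

InG : {r n : ℕ} .{{_ : NonZero r}} → (Fin n → ℕ) → CPerm r n → Set
InG f ρ = ∀ i → σval ρ i ≤ f i

-- Suppose σ′ᵢ = m exceeds fᵢ = max{σ₁,…,σᵢ}, where σ′ is the base permutation of ρ = φ(π).
-- Then σ₁,…,σᵢ are i distinct values below m, so i < m; as ρ⁻¹ sends m to base value i ≤ m,
-- the B-code of ρ at m is i. But σ⁻¹(m) lies after position i, so m and σ₁,…,σᵢ all count
-- towards the A-code of π at m, which is therefore at least i + 1.
module Submission where

open import Defs
open import Data.Nat using (ℕ; NonZero; suc; _⊔_; _≤_; _<_)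
open import Data.Nat.Properties
  using (≤-trans; ≤-refl; <⇒≤; ≤-pred; m≤m⊔n; m≤n⊔m; <-irrefl; ≰⇒>; ≮⇒≥; _≤?_)
open import Data.Fin as Fin using (Fin; toℕ; inject≤; fromℕ<)
open import Data.Fin.Properties
  using (toℕ<n; toℕ-inject≤; inject≤-injective; injective⇒≤; toℕ-injective; toℕ-fromℕ<)
  renaming (_≤?_ to _≤?ᶠ_)
open import Data.Fin.Permutation using (Permutation′; _⟨$⟩ʳ_; _⟨$⟩ˡ_; inverseˡ; inverseʳ)
open import Data.List using (List; _∷_; length; filter; foldr; allFin; lookup)
open import Data.List.Relation.Unary.Any using (here; there; index)
open import Data.List.Relation.Unary.Any.Properties using (lookup-index)
open import Data.List.Membership.Propositional using (_∈_)
open import Data.List.Membership.Propositional.Properties using (∈-filter⁺; ∈-allFin; ∈-map⁺)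
open import Data.Product using (_×_; _,_; proj₁)
open import Data.Empty using (⊥-elim)
open import Function.Bundles using (Injection)
open import Function.Definitions using (Injective)
open import Function.Properties.Inverse using (↔⇒↣)
open import Relation.Nullary using (yes; no)
open import Relation.Unary using (Pred; Decidable)
open import Relation.Binary.PropositionalEquality using (_≡_; refl; sym; trans; cong; subst)

⟨$⟩ʳ-injective : ∀ {n} (s : Permutation′ n) → Injective _≡_ _≡_ (s ⟨$⟩ʳ_)
⟨$⟩ʳ-injective s = Injection.injective (↔⇒↣ s)

∈⇒≤-foldr-⊔ : ∀ {x : ℕ} {xs : List ℕ} → x ∈ xs → x ≤ foldr _⊔_ 0 xs
∈⇒≤-foldr-⊔ {xs = y ∷ ys} (here refl) = m≤m⊔n y _
∈⇒≤-foldr-⊔ {xs = y ∷ ys} (there x∈ys) = ≤-trans (∈⇒≤-foldr-⊔ x∈ys) (m≤n⊔m y _)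

injection⇒≤-length-filter : ∀ {n k p} {P : Pred (Fin n) p} (P? : Decidable P) (g : Fin k → Fin n) →
  Injective _≡_ _≡_ g → (∀ x → P (g x)) → k ≤ length (filter P? (allFin n))
injection⇒≤-length-filter {n} P? g g-injective Pg = injective⇒≤ position-injective
  where
  member : ∀ x → g x ∈ filter P? (allFin n)
  member x = ∈-filter⁺ P? (∈-allFin (g x)) (Pg x)

  position-injective : Injective _≡_ _≡_ (λ x → index (member x))
  position-injective {x} {y} eq = g-injective
    (trans (lookup-index (member x))
      (trans (cong (lookup (filter P? (allFin n))) eq) (sym (lookup-index (member y)))))

inject≤-prefix : ∀ {n} (i : Fin n) → Fin (suc (toℕ i)) → Fin n
inject≤-prefix i x = inject≤ x (toℕ<n i)

inject≤-prefix-≤ : ∀ {n} (i : Fin n) (x : Fin (suc (toℕ i))) → inject≤-prefix i x Fin.≤ i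
inject≤-prefix-≤ i x = subst (_≤ toℕ i) (sym (toℕ-inject≤ x (toℕ<n i))) (≤-pred (toℕ<n x))

inject≤-prefix-injective : ∀ {n} (i : Fin n) → Injective _≡_ _≡_ (inject≤-prefix i)
inject≤-prefix-injective i {x} {y} = inject≤-injective (toℕ<n i) (toℕ<n i) x y

-- The prefix σ₀,…,σᵢ of a permutation consists of i + 1 distinct values.
prefix-bounded⇒< : ∀ {n} (s : Permutation′ n) (i m : Fin n) →
  (∀ j → j Fin.≤ i → s ⟨$⟩ʳ j Fin.< m) → i Fin.< m
prefix-bounded⇒< s i m bounded = injective⇒≤ {f = below-m} below-m-injective
  where
  below : ∀ x → toℕ (s ⟨$⟩ʳ inject≤-prefix i x) < toℕ m
  below x = bounded (inject≤-prefix i x) (inject≤-prefix-≤ i x)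

  below-m : Fin (suc (toℕ i)) → Fin (toℕ m)
  below-m x = fromℕ< (below x)

  below-m-injective : Injective _≡_ _≡_ below-m
  below-m-injective {x} {y} eq = inject≤-prefix-injective i (⟨$⟩ʳ-injective s (toℕ-injective
    (trans (sym (toℕ-fromℕ< (below x))) (trans (cong toℕ eq) (toℕ-fromℕ< (below y))))))

module _ {r n : ℕ} .{{_ : NonZero r}} (π : CPerm r n) where

  ≤⇒σval≤minSeq : ∀ {i j} → j Fin.≤ i → σval π j ≤ minSeq π i
  ≤⇒σval≤minSeq {i} {j} j≤i =
    ∈⇒≤-foldr-⊔ (∈-map⁺ (σval π) (∈-filter⁺ (_≤?ᶠ i) (∈-allFin j) j≤i))

  -- If m is larger than σ₀,…,σᵢ, then m together with σ₀,…,σᵢ are i + 2 values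
  -- counted by the A-code at m, since σ⁻¹(m) comes after position i.
  prefix-bounded⇒Acode-> : ∀ (i m : Fin n) → (∀ j → j Fin.≤ i → σ π ⟨$⟩ʳ j Fin.< m) →
    suc (suc (toℕ i)) ≤ proj₁ (Acode π m)
  prefix-bounded⇒Acode-> i m bounded = injection⇒≤-length-filter _ counted counted-injective counted-valid
    where
    s = σ π
    p = s ⟨$⟩ˡ m

    i≤p : i Fin.≤ p
    i≤p = ≮⇒≥ λ p<i → <-irrefl (cong toℕ (inverseʳ s)) (bounded p (<⇒≤ p<i))

    below : ∀ x → s ⟨$⟩ʳ inject≤-prefix i x Fin.< m
    below x = bounded (inject≤-prefix i x) (inject≤-prefix-≤ i x)

    counted : Fin (suc (suc (toℕ i))) → Fin n
    counted Fin.zero    = m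
    counted (Fin.suc x) = s ⟨$⟩ʳ inject≤-prefix i x

    counted-injective : Injective _≡_ _≡_ counted
    counted-injective {Fin.zero}  {Fin.zero}  eq = refl
    counted-injective {Fin.zero}  {Fin.suc y} eq = ⊥-elim (<-irrefl (cong toℕ (sym eq)) (below y))
    counted-injective {Fin.suc x} {Fin.zero}  eq = ⊥-elim (<-irrefl (cong toℕ eq) (below x))
    counted-injective {Fin.suc x} {Fin.suc y} eq =
      cong Fin.suc (inject≤-prefix-injective i (⟨$⟩ʳ-injective s eq))

    counted-valid : ∀ x → (counted x Fin.≤ m) × (s ⟨$⟩ˡ counted x Fin.≤ p)
    counted-valid Fin.zero    = ≤-refl , ≤-refl
    counted-valid (Fin.suc x) = <⇒≤ (below x) ,
      subst (Fin._≤ p) (sym (inverseˡ s)) (≤-trans (inject≤-prefix-≤ i x) i≤p)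

Bcode-first-step : ∀ {r n} .{{_ : NonZero r}} (ρ : CPerm r n) m →
  σ ρ ⟨$⟩ˡ m Fin.≤ m → proj₁ (Bcode ρ m) ≡ suc (toℕ (σ ρ ⟨$⟩ˡ m))
Bcode-first-step {n = suc _} ρ m stops with σ ρ ⟨$⟩ˡ m ≤?ᶠ m
... | yes _   = refl
... | no  ¬le = ⊥-elim (¬le stops)

lemma4p4 : (r n : ℕ) .{{_ : NonZero r}} (π ρ : CPerm r n) →
    (∀ i → Bcode ρ i ≡ Acode π i) → InG (minSeq π) ρ
lemma4p4 r n π ρ codes-agree i with σval ρ i ≤? minSeq π i
... | yes σ′ᵢ≤fᵢ = σ′ᵢ≤fᵢ
... | no  σ′ᵢ≰fᵢ = ⊥-elim (<-irrefl refl (subst (suc (suc (toℕ i)) ≤_) Acode≡suc-i Acode-large))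
  where
  m = σ ρ ⟨$⟩ʳ i

  bounded : ∀ j → j Fin.≤ i → σ π ⟨$⟩ʳ j Fin.< m
  bounded j j≤i = ≤-trans (≤⇒σval≤minSeq π j≤i) (≤-pred (≰⇒> σ′ᵢ≰fᵢ))

  ρ⁻¹m≡i : σ ρ ⟨$⟩ˡ m ≡ i
  ρ⁻¹m≡i = inverseˡ (σ ρ)

  Acode≡suc-i : proj₁ (Acode π m) ≡ suc (toℕ i)
  Acode≡suc-i = trans (cong proj₁ (sym (codes-agree m)))
    (trans (Bcode-first-step ρ m (subst (Fin._≤ m) (sym ρ⁻¹m≡i) (<⇒≤ (prefix-bounded⇒< (σ π) i m bounded))))
      (cong (λ k → suc (toℕ k)) ρ⁻¹m≡i))

  Acode-large : suc (suc (toℕ i)) ≤ proj₁ (Acode π m)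
  Acode-large = prefix-bounded⇒Acode-> π i m bounded
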